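{- There is an absolute constant $c>0$ such that for every binary search tree $T$ on $n$ nodes there exists a sequence of at most $c\cdot n$ rotations starting from $T$ such that (i) every rotation involves only nodes at depth at most $3$ (in the current tree), and (ii) every node of $T$ becomes the root at some point during the sequence.
   Context: The depth of a node is the number of nodes on the path from the root to it (so the root has depth 1). Rotations are the standard binary search tree rotations. -}

module Defs where

open import Data.Nat using (ℕ; suc; _<_)
open import Data.List using (List; []; _∷_; _++_; length)
open import Data.Maybe using (Maybe; just; nothing)
open import Data.List.Relation.Unary.Linked using (Linked)

data Tree : Set where
  leaf : Tree
  node : Tree → ℕ → Tree → Tree

-- In-order traversal (list of keys = list of nodes).
inorder : Tree → List ℕ
inorder leaf = []
inorder (node l k r) = inorder l ++ (k ∷ inorder r)

size : Tree → ℕ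
size t = length (inorder t)

IsBST : Tree → Set
IsBST t = Linked _<_ (inorder t)

root : Tree → Maybe ℕ
root leaf = nothing
root (node _ k _) = just k

-- Rot d T U : U is obtained from T by a single standard rotation whose
-- upper node (the parent of the rotated edge) is at depth d in T
-- (root has depth 1).
data Rot : ℕ → Tree → Tree → Set where
  rotR : ∀ {a x b y c} →
         Rot 1 (node (node a x b) y c) (node a x (node b y c))
  rotL : ∀ {a x b y c} →
         Rot 1 (node a x (node b y c)) (node (node a x b) y c)
  inL  : ∀ {d l l' k r} → Rot d l l' → Rot (suc d) (node l k r) (node l' k r)
  inR  : ∀ {d l k r r'} → Rot d r r' → Rot (suc d) (node l k r) (node l k r')

-- A rotation involving only nodes at depth ≤ 3: its upper node has depth d
-- and its lower node depth d+1, so the condition is d + 1 ≤ 3.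
ShallowRot : Tree → Tree → Set
ShallowRot T U = Data.Product.Σ ℕ (λ d → Rot d T U Data.Product.× suc d Data.Nat.≤ 3)
  where import Data.Product
        import Data.Nat

-- Walk T us : starting from T, the list us is the successive trees obtained
-- by a sequence of shallow rotations (length us = number of rotations).
data Walk : Tree → List Tree → Set where
  done : ∀ {T} → Walk T []
  step : ∀ {T U us} → ShallowRot T U → Walk U us → Walk T (U ∷ us)

module Submission where

-- The root is moved through all keys in increasing order. Right rotations at
-- the root first bring each node of the left spine, ending with the minimum,
-- to the root. From then on the root x has a right subtree node L s D, and the
-- keys of L followed by s become root one after another: a right rotation at
-- depth 2 lifts the root of L to be the right child of x, a left rotation at
-- the root promotes that right child once its left subtree is empty, and
-- everything passed over accumulates in the left subtree. Every rotation
-- involves the root and one of its children, or a child and a grandchild,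
-- and each key is charged at most three of them.

open import Defs
open import Data.Nat using (ℕ; _<_; _≤_; _*_; _+_; suc; z≤n; s≤s)
open import Data.Nat.Properties using (+-monoʳ-≤; m≤m+n; n≤1+n; module ≤-Reasoning)
open import Data.Nat.Tactic.RingSolver using (solve-∀)
open import Data.Product using (Σ; _×_; _,_)
open import Data.Sum using (inj₁; inj₂)
open import Data.List using (List; _∷_; []; length; _++_)
open import Data.List.Properties using (length-++; ++-assoc)
open import Data.Maybe using (just)
open import Data.List.Membership.Propositional using (_∈_)
open import Data.List.Membership.Propositional.Properties using (∈-++⁻)
open import Data.List.Relation.Binary.Subset.Propositional.Properties using (⊆-reflexive)
open import Data.List.Relation.Unary.Any using (Any; here; there)
open import Data.List.Relation.Unary.Any.Properties using (++⁺ˡ; ++⁺ʳ)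
open import Relation.Binary.PropositionalEquality using (_≡_; refl; sym; trans; cong; cong₂; module ≡-Reasoning)
open import Function using (_∘_)

size-node : ∀ l k r → size (node l k r) ≡ size l + suc (size r)
size-node l k r = length-++ (inorder l)

rotR-root : ∀ {a x b y c} → ShallowRot (node (node a x b) y c) (node a x (node b y c))
rotR-root = 1 , rotR , s≤s (s≤s z≤n)

rotL-root : ∀ {a x b y c} → ShallowRot (node a x (node b y c)) (node (node a x b) y c)
rotL-root = 1 , rotL , s≤s (s≤s z≤n)

rotR-right : ∀ {l k a x b y c} →
  ShallowRot (node l k (node (node a x b) y c)) (node l k (node a x (node b y c)))
rotR-right = 2 , inR rotR , s≤s (s≤s (s≤s z≤n))

data Path : Tree → List Tree → Tree → Set where
  ε   : ∀ {T} → Path T [] T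
  _◅_ : ∀ {T U us V} → ShallowRot T U → Path U us V → Path T (U ∷ us) V

infixr 5 _◅_ _◅◅_

_◅◅_ : ∀ {T us U vs V} → Path T us U → Path U vs V → Path T (us ++ vs) V
ε       ◅◅ q = q
(r ◅ p) ◅◅ q = r ◅ (p ◅◅ q)

Path⇒Walk : ∀ {T us V} → Path T us V → Walk T us
Path⇒Walk ε       = done
Path⇒Walk (r ◅ p) = step r (Path⇒Walk p)

_⊆Roots_ : List ℕ → List Tree → Set
ks ⊆Roots us = ∀ {k} → k ∈ ks → Any (λ U → root U ≡ just k) us

⊆Roots-++ : ∀ {ks ms us vs} → ks ⊆Roots us → ms ⊆Roots vs → (ks ++ ms) ⊆Roots (us ++ vs)
⊆Roots-++ {ks} {us = us} p q k∈ with ∈-++⁻ ks k∈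
... | inj₁ k∈ks = ++⁺ˡ (p k∈ks)
... | inj₂ k∈ms = ++⁺ʳ us (q k∈ms)

∷-⊆Roots : ∀ {k ks U us} → root U ≡ just k → ks ⊆Roots us → (k ∷ ks) ⊆Roots (U ∷ us)
∷-⊆Roots e p (here refl) = here e
∷-⊆Roots e p (there k∈) = there (p k∈)

passed : Tree → ℕ → Tree → Tree
passed A x leaf           = node A x leaf
passed A x (node L₁ z L₂) = passed (passed A x L₁) z L₂

advance : Tree → ℕ → Tree → ℕ → Tree → List Tree
advance A x leaf           s D = node (node A x leaf) s D ∷ []
advance A x (node L₁ z L₂) s D =
  node A x (node L₁ z (node L₂ s D)) ∷
  (advance A x L₁ z (node L₂ s D) ++ advance (passed A x L₁) z L₂ s D)

advance-path : ∀ A x L s D →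
  Path (node A x (node L s D)) (advance A x L s D) (node (passed A x L) s D)
advance-path A x leaf           s D = rotL-root ◅ ε
advance-path A x (node L₁ z L₂) s D =
  rotR-right ◅ advance-path A x L₁ z (node L₂ s D) ◅◅ advance-path (passed A x L₁) z L₂ s D

length-advance : ∀ A x L s D → length (advance A x L s D) ≡ suc (2 * size L)
length-advance A x leaf           s D = refl
length-advance A x (node L₁ z L₂) s D = begin
  suc (length (advance A x L₁ z (node L₂ s D) ++ advance (passed A x L₁) z L₂ s D))
    ≡⟨ cong suc (length-++ (advance A x L₁ z (node L₂ s D))) ⟩
  suc (length (advance A x L₁ z (node L₂ s D)) + length (advance (passed A x L₁) z L₂ s D))
    ≡⟨ cong suc (cong₂ _+_ (length-advance A x L₁ z (node L₂ s D))
                          (length-advance (passed A x L₁) z L₂ s D)) ⟩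
  suc (suc (2 * size L₁) + suc (2 * size L₂))
    ≡⟨ cong suc (double (size L₁) (size L₂)) ⟩
  suc (2 * (size L₁ + suc (size L₂)))
    ≡⟨ cong (λ m → suc (2 * m)) (sym (size-node L₁ z L₂)) ⟩
  suc (2 * size (node L₁ z L₂)) ∎
  where
  open ≡-Reasoning
  double : ∀ a b → suc (2 * a) + suc (2 * b) ≡ 2 * (a + suc b)
  double = solve-∀

advance-roots : ∀ A x L s D → (inorder L ++ s ∷ []) ⊆Roots advance A x L s D
advance-roots A x leaf           s D = ∷-⊆Roots refl (λ ())
advance-roots A x (node L₁ z L₂) s D =
  there ∘ ⊆Roots-++ (advance-roots A x L₁ z (node L₂ s D))
                     (advance-roots (passed A x L₁) z L₂ s D)
        ∘ ⊆-reflexive (reassoc (inorder L₁) (inorder L₂))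
  where
  reassoc : ∀ xs ys → (xs ++ z ∷ ys) ++ s ∷ [] ≡ (xs ++ z ∷ []) ++ (ys ++ s ∷ [])
  reassoc xs ys = trans (++-assoc xs (z ∷ ys) (s ∷ [])) (sym (++-assoc xs (z ∷ []) (ys ++ s ∷ [])))

sweep : Tree → ℕ → Tree → List Tree
sweep A x leaf         = []
sweep A x (node L s D) = advance A x L s D ++ sweep (passed A x L) s D

sweep-path : ∀ A x D → Path (node A x D) (sweep A x D) (passed A x D)
sweep-path A x leaf         = ε
sweep-path A x (node L s D) = advance-path A x L s D ◅◅ sweep-path (passed A x L) s D

length-sweep : ∀ A x D → length (sweep A x D) ≤ 2 * size D
length-sweep A x leaf         = z≤n
length-sweep A x (node L s D) = begin
  length (advance A x L s D ++ sweep (passed A x L) s D)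
    ≡⟨ length-++ (advance A x L s D) ⟩
  length (advance A x L s D) + length (sweep (passed A x L) s D)
    ≡⟨ cong (_+ length (sweep (passed A x L) s D)) (length-advance A x L s D) ⟩
  suc (2 * size L) + length (sweep (passed A x L) s D)
    ≤⟨ +-monoʳ-≤ (suc (2 * size L)) (length-sweep (passed A x L) s D) ⟩
  suc (2 * size L) + 2 * size D
    ≤⟨ n≤1+n _ ⟩
  suc (suc (2 * size L) + 2 * size D)
    ≡⟨ double (size L) (size D) ⟩
  2 * (size L + suc (size D))
    ≡⟨ cong (2 *_) (sym (size-node L s D)) ⟩
  2 * size (node L s D) ∎
  where
  open ≤-Reasoning
  double : ∀ a b → suc (suc (2 * a) + 2 * b) ≡ 2 * (a + suc b)
  double = solve-∀

sweep-roots : ∀ A x D → inorder D ⊆Roots sweep A x D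
sweep-roots A x leaf         = λ ()
sweep-roots A x (node L s D) =
  ⊆Roots-++ (advance-roots A x L s D) (sweep-roots (passed A x L) s D)
    ∘ ⊆-reflexive (sym (++-assoc (inorder L) (s ∷ []) (inorder D)))

tour : Tree → ℕ → Tree → List Tree
tour leaf         x r = sweep leaf x r
tour (node a x b) y c = node a x (node b y c) ∷ tour a x (node b y c)

tour-walk : ∀ a x r → Walk (node a x r) (tour a x r)
tour-walk leaf         x r = Path⇒Walk (sweep-path leaf x r)
tour-walk (node a x b) y c = step rotR-root (tour-walk a x (node b y c))

length-tour : ∀ a x r → length (tour a x r) ≤ 3 * size a + 2 * size r
length-tour leaf         x r = length-sweep leaf x r
length-tour (node a x b) y c = begin
  suc (length (tour a x (node b y c)))
    ≤⟨ s≤s (length-tour a x (node b y c)) ⟩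
  suc (3 * size a + 2 * size (node b y c))
    ≡⟨ cong (λ m → suc (3 * size a + 2 * m)) (size-node b y c) ⟩
  suc (3 * size a + 2 * (size b + suc (size c)))
    ≤⟨ m≤m+n _ (size b) ⟩
  suc (3 * size a + 2 * (size b + suc (size c))) + size b
    ≡⟨ regroup (size a) (size b) (size c) ⟩
  3 * (size a + suc (size b)) + 2 * size c
    ≡⟨ cong (λ m → 3 * m + 2 * size c) (sym (size-node a x b)) ⟩
  3 * size (node a x b) + 2 * size c ∎
  where
  open ≤-Reasoning
  regroup : ∀ a b c → suc (3 * a + 2 * (b + suc c)) + b ≡ 3 * (a + suc b) + 2 * c
  regroup = solve-∀

-- The first right rotation preserves the in-order traversal.
tour-roots : ∀ a x r → inorder (node a x r) ⊆Roots (node a x r ∷ tour a x r)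
tour-roots leaf         x r = ∷-⊆Roots refl (sweep-roots leaf x r)
tour-roots (node a x b) y c =
  there ∘ tour-roots a x (node b y c)
    ∘ ⊆-reflexive (++-assoc (inorder a) (x ∷ inorder b) (y ∷ inorder c))

lemma7 : Σ ℕ (λ c → 0 < c × ((n : ℕ) (T : Tree) → IsBST T → size T ≡ n →
    Σ (List Tree) (λ us → Walk T us × length us ≤ c * n ×
    ((k : ℕ) → k ∈ inorder T → Any (λ U → root U ≡ just k) (T ∷ us)))))
lemma7 = 3 , s≤s z≤n , tour-from
  where
  tour-from : (n : ℕ) (T : Tree) → IsBST T → size T ≡ n →
    Σ (List Tree) (λ us → Walk T us × length us ≤ 3 * n ×
    ((k : ℕ) → k ∈ inorder T → Any (λ U → root U ≡ just k) (T ∷ us)))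
  tour-from n leaf         _ _ = [] , done , z≤n , λ k ()
  tour-from n (node a x r) _ refl =
    tour a x r , tour-walk a x r , length-bound , λ k → tour-roots a x r
    where
    length-bound : length (tour a x r) ≤ 3 * size (node a x r)
    length-bound = begin
      length (tour a x r)           ≤⟨ length-tour a x r ⟩
      3 * size a + 2 * size r       ≤⟨ m≤m+n _ (3 + size r) ⟩
      3 * size a + 2 * size r + (3 + size r)
        ≡⟨ regroup (size a) (size r) ⟩
      3 * (size a + suc (size r))   ≡⟨ cong (3 *_) (sym (size-node a x r)) ⟩
      3 * size (node a x r) ∎
      where
      open ≤-Reasoning
      regroup : ∀ a r → 3 * a + 2 * r + (3 + r) ≡ 3 * (a + suc r)
      regroup = solve-∀
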